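{- Let $m\ge1$ and let $\Lambda=(\pmb a;\lambda)$, $\Omega=(\pmb b;\mu)$ be $m$-partitions. If $b_\ell>a_\ell$ for some $\ell\in\{1,\dots,m\}$, or if $\lambda\not\subseteq\mu$, then $D_{\Lambda\Omega}(t)=0$.
   Context: $q,t$ indeterminates; $R_m=\mathbb Q(q,t)[x_1,\dots,x_m]\otimes\mathbf\Lambda_m$, $\mathbf\Lambda_m$ the symmetric functions in $x_{m+1},x_{m+2},\dots$. An $m$-partition is $\Lambda=(\pmb a;\lambda)$, $\pmb a\in\mathbb Z_{\ge0}^m$, $\lambda$ a partition; $\Omega=(\pmb b;\mu)$ denotes another one; $|\Lambda|=|\pmb a|+|\lambda|$; $\Lambda$ is dominant if $a_1\ge\dots\ge a_m$; $s_i\Lambda=((a_1,\dots,a_{i+1},a_i,\dots,a_m);\lambda)$; $\pmb a\cup\lambda$ is the decreasing rearrangement of all entries of $\pmb a$ and $\lambda$; $\lambda\subseteq\mu$ is containment of Young diagrams. Hecke operators on $R_m$: $T_i=t+\frac{tx_i-x_{i+1}}{x_i-x_{i+1}}(K_{i,i+1}-1)$, $1\le i\le m-1$, $K_{i,i+1}$ exchanging $x_i,x_{i+1}$. $H_{\pmb a}(x_1,\dots,x_m;t)$ is the non-symmetric Hall–Littlewood polynomial (the non-symmetric Macdonald polynomial $E_{\pmb a}(x_1,\dots,x_m;q,t)$ at $q=0$); $H_{\pmb a}=x^{\pmb a}$ when $\pmb a$ is dominant and $H_{s_i\pmb a}=T_iH_{\pmb a}$ when $a_i>a_{i+1}$.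 $k_\Lambda(x;t)=H_{\pmb a}(x_1,\dots,x_m;t)\,s_\lambda(x_1,x_2,\dots)$; these form a basis of $R_m$. $\langle\cdot,\cdot\rangle_m$ is the bilinear form with $\langle k_\Lambda,k_\Omega\rangle_m=\delta_{\Lambda\Omega}$, and $T_i^*$ is the adjoint of $T_i$. Words and charge. Action of the symmetric group on words in letters $1,2,\dots$: for a word $w$ and $i\ge1$, in the subword of letters $i,i+1$ bracket every letter $i+1$ immediately followed (in that subword) by a letter $i$, delete bracketed pairs and repeat until the unbracketed letters read $i^r(i+1)^s$; $\sigma_i(w)$ replaces these unbracketed letters by $i^s(i+1)^r$ in the same positions. Charge of a word $w$ with weakly decreasing evaluation: in one pass, start with counter $\ell=0$ at the right end, scan leftwards, label the first unlabeled $1$ met with $\ell$, continue leftwards to the first unlabeled $2$ and label it $\ell$, then $3$, etc.; whenever the scan passes the left end it resumes at the right end and $\ell$ increases by $1$; the pass ends after labeling the largest letter $k$ such that $1,\dots,k$ all had unlabeled occurrences at the start of the pass. Repeat on unlabeled letters until all are labeled; charge$(w)$ is the sum of labels. For general $w$, charge$(w)$=charge$(\sigma(w))$ for any $\sigma$ with $\sigma(w)$ of weakly decreasing evaluation. The charge of a word in letters $\bar1,\dots,\bar m$ is that of the word obtained by replacing each $\bar i$ by $m+1-i$. Tableaux. A skew tableau is a filling of a skew diagram weakly increasing along rows and strictly increasing down columns; its reading word $w(T)$ reads rows from bottom to top, left to right. For dominant $\Lambda$ and $|\Omega|=|\Lambda|$, $\mathcal S_{\Lambda\Omega}$ is the set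 of skew tableaux of shape $(\pmb a\cup\lambda)/\mu$ in letters $1<\dots<m$ with letter $i$ appearing $b_i$ times, all in columns $1,\dots,a_i$ (empty if $\mu\not\subseteq\pmb a\cup\lambda$). For $T\in\mathcal S_{\Lambda\Omega}$, $\bar T$ is the filling of $\mu/\lambda$ whose column $c$ consists of the letters $\bar i$, for those $i$ with $c\le a_i$ such that column $c$ of $T$ has no $i$, placed with indices decreasing from top to bottom. $u_{\pmb a}=\bar2^{a_1-a_2}\cdots\bar m^{a_1-a_m}$, ${\rm Inv}(\pmb b)=\#\{i<j:b_i<b_j\}$, ${\rm charge}_{\pmb a,\pmb b}(T)={\rm Inv}(\pmb b)+{\rm charge}(w(\bar T)u_{\pmb a})$. Dual $m$-symmetric Schur functions: for dominant $\Lambda$, $s^*_\Lambda(x;t)=\sum_\Omega D_{\Lambda\Omega}(t)k_\Omega(x;t)$ with $D_{\Lambda\Omega}(t)=\sum_{T\in\mathcal S_{\Lambda\Omega}}t^{{\rm charge}_{\pmb a,\pmb b}(T)}$; if $a_i<a_{i+1}$, $s^*_\Lambda=t^{ -1}T_i^*s^*_{s_i\Lambda}$ (recursively). In general $D_{\Lambda\Omega}(t)$ is the coefficient of $k_\Omega(x;t)$ in $s^*_\Lambda(x;t)$. -}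

module Defs where

open import Data.Nat using (ℕ; zero; suc; _+_; _∸_; _≤_; _<_; _≥_; _≤ᵇ_; _<ᵇ_; _≡ᵇ_; _⊔_)
open import Data.Bool using (Bool; true; false; if_then_else_; _∧_; _∨_; not)
open import Data.List using (List; []; _∷_; _++_; map; foldr; foldl; length; reverse; concatMap; upTo; replicate; drop; concat)
open import Data.List.Relation.Unary.All using (All)
open import Data.List.Relation.Unary.Linked using (Linked)
open import Data.Maybe using (Maybe; just; nothing)
open import Data.Product using (_×_; _,_; proj₁; proj₂)
open import Data.Integer using (ℤ; +_; -[1+_]) renaming (_+_ to _+ℤ_; _-_ to _-ℤ_)
open import Data.Vec using (Vec; toList)

IsPartition : List ℕ → Set
IsPartition p = Linked _≥_ p × All (λ x → 0 < x) p

-- i-th entry (0-indexed) of a list, 0 if out of range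
at : List ℕ → ℕ → ℕ
at []       _       = 0
at (x ∷ _)  zero    = x
at (_ ∷ xs) (suc n) = at xs n

_⊆ₚ_ : List ℕ → List ℕ → Set
lam ⊆ₚ mu = (i : ℕ) → at lam i ≤ at mu i

keep : {A : Set} → (A → Bool) → List A → List A
keep p []       = []
keep p (x ∷ xs) = if p x then x ∷ keep p xs else keep p xs

countᵇ : {A : Set} → (A → Bool) → List A → ℕ
countᵇ p xs = length (keep p xs)

allᵇ : {A : Set} → (A → Bool) → List A → Bool
allᵇ p []       = true
allᵇ p (x ∷ xs) = p x ∧ allᵇ p xs

nullᵇ : {A : Set} → List A → Bool
nullᵇ []      = true
nullᵇ (_ ∷ _) = false

atB : List Bool → ℕ → Bool
atB []       _       = false
atB (x ∷ _)  zero    = x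
atB (_ ∷ xs) (suc n) = atB xs n

setB : List Bool → ℕ → List Bool
setB []       _       = []
setB (_ ∷ xs) zero    = true ∷ xs
setB (x ∷ xs) (suc n) = x ∷ setB xs n

maxL : List ℕ → Maybe ℕ
maxL []       = nothing
maxL (x ∷ xs) with maxL xs
... | nothing = just x
... | just y  = just (x ⊔ y)

letters : ℕ → List ℕ
letters m = map suc (upTo m)

rangeFrom : ℕ → ℕ → List ℕ
rangeFrom lo hi = map (λ x → lo + x) (upTo (hi ∸ lo))

-- swap entries i and i+1 (0-indexed): the action of s_{i+1}
swapAt : ℕ → List ℕ → List ℕ
swapAt zero    (x ∷ y ∷ xs) = y ∷ x ∷ xs
swapAt (suc i) (x ∷ xs)     = x ∷ swapAt i xs
swapAt _       xs           = xs

insD : ℕ → List ℕ → List ℕ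
insD x []       = x ∷ []
insD x (y ∷ ys) = if y ≤ᵇ x then x ∷ y ∷ ys else y ∷ insD x ys

sortD : List ℕ → List ℕ
sortD = foldr insD []

cupP : List ℕ → List ℕ → List ℕ
cupP a lam = sortD (keep (λ x → 0 <ᵇ x) (a ++ lam))

inv : List ℕ → ℕ
inv []       = 0
inv (x ∷ xs) = countᵇ (x <ᵇ_) xs + inv xs

-- unmatched letters i (letters i+1 act as opening brackets, i as closing)
markL : ℕ → ℕ → List ℕ → List Bool
markL i o []       = []
markL i o (x ∷ xs) =
  if x ≡ᵇ suc i then false ∷ markL i (suc o) xs
  else if x ≡ᵇ i then markLi o
  else false ∷ markL i o xs
  where
  markLi : ℕ → List Bool
  markLi zero    = true ∷ markL i zero xs
  markLi (suc o') = false ∷ markL i o' xs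

-- unmatched letters i+1, computed on the reversed word
markR' : ℕ → ℕ → List ℕ → List Bool
markR' i c []       = []
markR' i c (x ∷ xs) =
  if x ≡ᵇ i then false ∷ markR' i (suc c) xs
  else if x ≡ᵇ suc i then markRi c
  else false ∷ markR' i c xs
  where
  markRi : ℕ → List Bool
  markRi zero     = true ∷ markR' i zero xs
  markRi (suc c') = false ∷ markR' i c' xs

markR : ℕ → List ℕ → List Bool
markR i w = reverse (markR' i 0 (reverse w))

orL : List Bool → List Bool → List Bool
orL (x ∷ xs) (y ∷ ys) = (x ∨ y) ∷ orL xs ys
orL _        _        = []

rebuild : ℕ → ℕ → ℕ → List ℕ → List Bool → List ℕ
rebuild i s k (x ∷ xs) (f ∷ fs) =
  if f then (if k <ᵇ s then i else suc i) ∷ rebuild i s (suc k) xs fs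
  else x ∷ rebuild i s k xs fs
rebuild i s k xs _ = xs

σ : ℕ → List ℕ → List ℕ
σ i w = rebuild i (countᵇ (λ b → b) (markR i w)) 0 w (orL (markL i 0 w) (markR i w))

cnt : ℕ → List ℕ → ℕ
cnt j w = countᵇ (_≡ᵇ j) w

-- apply σ_i's (bubble sort on the evaluation) to reach weakly decreasing evaluation
bubblePass : List ℕ → List ℕ → List ℕ
bubblePass is w = foldl (λ v i → if cnt i v <ᵇ cnt (suc i) v then σ i v else v) w is

sortEval' : ℕ → List ℕ → List ℕ → List ℕ
sortEval' zero    is w = w
sortEval' (suc f) is w = sortEval' f is (bubblePass is w)

sortEval : List ℕ → List ℕ
sortEval w = let N = foldr _⊔_ 0 w in sortEval' N (letters N) w

module ChargeP (w : List ℕ) where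
  n : ℕ
  n = length w

  cands : ℕ → List Bool → List ℕ
  cands j lab = keep (λ q → (at w q ≡ᵇ j) ∧ not (atB lab q)) (upTo n)

  -- state: (position, counter ℓ, labels, accumulated charge)
  State : Set
  State = ℕ × ℕ × List Bool × ℕ

  step : State → ℕ → State
  step (p , l , lab , acc) j with maxL (keep (_<ᵇ p) (cands j lab))
  ... | just q  = (q , l , setB lab q , acc + l)
  ... | nothing with maxL (cands j lab)
  ...   | just q  = (q , suc l , setB lab q , acc + suc l)
  ...   | nothing = (p , l , lab , acc)

  kOf : ℕ → ℕ → List Bool → ℕ
  kOf zero    j lab = 0
  kOf (suc f) j lab = if nullᵇ (cands j lab) then 0 else suc (kOf f (suc j) lab)

  pass : List Bool → List Bool × ℕ
  pass lab with foldl step (n , 0 , lab , 0) (letters (kOf n 1 lab))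
  ... | (_ , _ , lab' , acc) = (lab' , acc)

  passes : ℕ → List Bool → ℕ
  passes zero    lab = 0
  passes (suc f) lab = proj₂ (pass lab) + passes f (proj₁ (pass lab))

  chargeP : ℕ
  chargeP = passes n (replicate n false)

charge : List ℕ → ℕ
charge w = ChargeP.chargeP (sortEval w)

-- Tableaux S_{ΛΩ} for dominant Λ.
-- A filling of (ν/μ) is a list of rows; row r is a list of length ν_r
-- whose first μ_r entries are 0 (cells of μ) and whose other entries are
-- letters in 1..m.

allWords : ℕ → ℕ → List (List ℕ)
allWords m zero    = [] ∷ []
allWords m (suc k) = concatMap (λ x → map (x ∷_) (allWords m k)) (letters m)

fills : ℕ → List ℕ → List ℕ → List (List (List ℕ))
fills m []      mu = [] ∷ []
fills m (r ∷ nu) mu =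
  concatMap (λ w → map ((replicate (at mu 0) 0 ++ w) ∷_) (fills m nu (drop 1 mu)))
            (allWords m (r ∸ at mu 0))

incᵇ : List ℕ → Bool
incᵇ (x ∷ y ∷ xs) = (x ≤ᵇ y) ∧ incᵇ (y ∷ xs)
incᵇ _            = true

colStrict : List (List ℕ) → Bool
colStrict (R1 ∷ R2 ∷ Rs) =
  allᵇ (λ c → (at R2 c ≡ᵇ 0) ∨ (at R1 c <ᵇ at R2 c)) (upTo (length R2))
  ∧ colStrict (R2 ∷ Rs)
colStrict _ = true

containedᵇ : List ℕ → List ℕ → Bool
containedᵇ mu nu = allᵇ (λ r → at mu r ≤ᵇ at nu r) (upTo (length mu))

module Tab (m : ℕ) (a lam b mu : List ℕ) where
  -- a_i, b_i for 1-indexed i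
  aA : ℕ → ℕ
  aA i = at a (i ∸ 1)
  bA : ℕ → ℕ
  bA i = at b (i ∸ 1)

  nu : List ℕ
  nu = cupP a lam

  valid : List (List ℕ) → Bool
  valid T =
    allᵇ incᵇ T ∧ colStrict T
    ∧ allᵇ (λ i → cnt i (concat T) ≡ᵇ bA i) (letters m)
    ∧ allᵇ (λ R → allᵇ (λ c → (at R c ≡ᵇ 0) ∨ (c <ᵇ aA (at R c))) (upTo (length R))) T

  S : List (List (List ℕ))
  S = if containedᵇ mu nu then keep valid (fills m nu mu) else []

  colT : List (List ℕ) → ℕ → List ℕ
  colT T c = keep (λ x → not (x ≡ᵇ 0)) (map (λ R → at R c) T)

  colList : List (List ℕ) → ℕ → List ℕ
  colList T c = keep (λ i → (c <ᵇ aA i) ∧ nullᵇ (keep (_≡ᵇ i) (colT T c))) (reverse (letters m))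

  lamCol : ℕ → ℕ
  lamCol c = countᵇ (λ x → c <ᵇ x) lam

  -- reading word of T̄ (filling of μ/λ), barred letter ī recorded as m+1-i
  wbar : List (List ℕ) → List ℕ
  wbar T = concatMap
    (λ r → map (λ c → suc m ∸ at (colList T c) (r ∸ lamCol c)) (rangeFrom (at lam r) (at mu r)))
    (reverse (upTo (length mu)))

  -- u_a = 2̄^{a1-a2} ... m̄^{a1-am}, ī recorded as m+1-i
  ua : List ℕ
  ua = concatMap (λ i → replicate (at a 0 ∸ aA i) (suc m ∸ i)) (map (λ x → 2 + x) (upTo (m ∸ 1)))

  chargeAB : List (List ℕ) → ℕ
  chargeAB T = inv b + charge (wbar T ++ ua)

  -- D_{ΛΩ}(t) as Laurent polynomial: coefficient of t^k
  Ddom : ℤ → ℤ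
  Ddom (+ k)    = + countᵇ (λ T → chargeAB T ≡ᵇ k) S
  Ddom -[1+ _ ] = + 0

-- General Λ via s*_Λ = t^{-1} T_i^* s*_{s_i Λ}  (a_i < a_{i+1}).
-- Laurent polynomials in t are coefficient functions ℤ → ℤ.

firstAsc : List ℕ → Maybe ℕ
firstAsc (x ∷ y ∷ xs) = if x <ᵇ y then just 0 else Data.Maybe.map suc (firstAsc (y ∷ xs))
firstAsc _            = nothing

Drec : ℕ → ℕ → List ℕ → List ℕ → List ℕ → List ℕ → ℤ → ℤ
Drec m zero    a lam b mu = Tab.Ddom m a lam b mu
Drec m (suc f) a lam b mu with firstAsc a
... | nothing = Tab.Ddom m a lam b mu
... | just i  =
  let a' = swapAt i a
      c  = Drec m f a' lam b mu
      c' = Drec m f a' lam (swapAt i b) mu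
  in if at b (suc i) <ᵇ at b i then (λ k → c' (k +ℤ + 1))
     else if at b i ≡ᵇ at b (suc i) then c
     else (λ k → (c k -ℤ c (k +ℤ + 1)) +ℤ c' k)

D : (m : ℕ) → Vec ℕ m → List ℕ → Vec ℕ m → List ℕ → ℤ → ℤ
D m a lam b mu = Drec m (inv (toList a)) (toList a) lam (toList b) mu

{-# OPTIONS --safe #-}
module Submission where

-- For dominant Λ, D_ΛΩ counts the tableaux of S_ΛΩ, and there are none. Write ν = a ∪ λ and ′ for
-- conjugate partitions. In a column-strict filling of ν/μ every cell ≤ i sits below a cell < i, so,
-- counting upwards from the bottom row, letter i occurs at most as often as there are cells in the
-- first a_i columns of a single row: b_i ≤ a_i. Column c holds ν′_c − μ′_c distinct letters i, each
-- with c < a_i, so ν′_c − μ′_c ≤ a′_c; since ν′_c = a′_c + λ′_c, this is λ′_c ≤ μ′_c for every c,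
-- i.e. λ ⊆ μ. For general Λ, the recursion s*_Λ = t⁻¹ T_i* s*_{s_iΛ} at an ascent a_i < a_{i+1}
-- expresses D_ΛΩ through D_{s_iΛ,Ω} and D_{s_iΛ,s_iΩ}, and both hypotheses pass to these pairs.

open import Defs
open import Data.Bool using (Bool; true; false; T; _∨_)
open import Data.Bool.Properties using (T-∧; T-∨; T-≡)
open import Data.Empty using (⊥-elim)
open import Data.Maybe using (just; nothing)
open import Data.List using (List; []; _∷_; _++_; map; length; filterᵇ; take; drop; replicate; concat; upTo)
open import Data.List.Properties using (length-take; length-++; length-replicate; ++-identityʳ)
open import Data.List.Relation.Binary.Permutation.Propositional using (_↭_; ↭-refl; ↭-trans; prep; swap)
open import Data.List.Relation.Binary.Permutation.Propositional.Properties using (↭-length; filter-↭)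
open import Data.List.Relation.Unary.All as All using (All; []; _∷_)
open import Data.List.Relation.Unary.All.Properties using (concat⁺; map⁺; map⁻; applyUpTo⁻)
open import Data.List.Relation.Unary.AllPairs using (AllPairs; []; _∷_)
open import Data.List.Relation.Unary.Linked as Linked using (Linked; []; [-]; _∷_)
open import Data.Nat using (ℕ; zero; suc; _+_; _∸_; _≤_; _<_; _≥_; _<ᵇ_; _≤ᵇ_; _≡ᵇ_; z≤n; s≤s; z<s; s<s; _⊓_)
open import Data.Nat.Properties
open import Data.Integer using (ℤ; +_; -[1+_]) renaming (_+_ to _+ℤ_)
open import Algebra.Properties.CommutativeSemigroup +-commutativeSemigroup using (interchange)
open import Data.Product using (Σ; _×_; _,_; proj₁; proj₂)
open import Data.Sum using (_⊎_; inj₁; inj₂; [_,_]′)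
open import Data.Fin using (Fin; zero; suc; toℕ)
open import Data.Vec using (Vec; _∷_; lookup; toList)
open import Data.Vec.Properties using (length-toList)
open import Function using (_∘_; id)
open import Function.Bundles using (Equivalence)
open import Relation.Binary.PropositionalEquality
open import Relation.Nullary using (¬_; yes; no)
open import Relation.Nullary.Decidable using (proof)
open import Relation.Nullary.Reflects using (ofʸ; ofⁿ)

at-beyond : ∀ xs {r} → length xs ≤ r → at xs r ≡ 0
at-beyond []       _       = refl
at-beyond (x ∷ xs) (s≤s p) = at-beyond xs p

at-positive⇒< : ∀ xs {r} → 0 < at xs r → r < length xs
at-positive⇒< xs {r} pos with r <? length xs
... | yes r<len = r<len
... | no  r≮len = ⊥-elim (<-irrefl (sym (at-beyond xs (≮⇒≥ r≮len))) pos)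

at-positive : ∀ {w : List ℕ} {c} → All (0 <_) w → c < length w → 0 < at w c
at-positive {c = zero}  (px ∷ _)   _         = px
at-positive {c = suc c} (_  ∷ pxs) (s≤s c<) = at-positive pxs c<

indicator : Bool → ℕ
indicator true  = 1
indicator false = 0

countᵇ-∷ : ∀ {A : Set} (p : A → Bool) x xs → countᵇ p (x ∷ xs) ≡ indicator (p x) + countᵇ p xs
countᵇ-∷ p x xs with p x
... | true  = refl
... | false = refl

countᵇ-++ : ∀ {A : Set} (p : A → Bool) xs ys → countᵇ p (xs ++ ys) ≡ countᵇ p xs + countᵇ p ys
countᵇ-++ p []       ys = refl
countᵇ-++ p (x ∷ xs) ys with p x
... | true  = cong suc (countᵇ-++ p xs ys)
... | false = countᵇ-++ p xs ys

countᵇ-≤-length : ∀ {A : Set} (p : A → Bool) xs → countᵇ p xs ≤ length xs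
countᵇ-≤-length p []       = z≤n
countᵇ-≤-length p (x ∷ xs) with p x
... | true  = s≤s (countᵇ-≤-length p xs)
... | false = m≤n⇒m≤1+n (countᵇ-≤-length p xs)

countᵇ-accept : ∀ {A : Set} (p : A → Bool) {x xs} → T (p x) → countᵇ p (x ∷ xs) ≡ suc (countᵇ p xs)
countᵇ-accept p {x} px with p x
... | true = refl

countᵇ-≤-∷ : ∀ {A : Set} (p : A → Bool) x xs → countᵇ p xs ≤ countᵇ p (x ∷ xs)
countᵇ-≤-∷ p x xs with p x
... | true  = n≤1+n _
... | false = ≤-refl

countᵇ-∷-mono : ∀ {A : Set} (p q : A → Bool) {x y xs ys} → (T (p y) → T (q x))
  → countᵇ p ys ≤ countᵇ q xs → countᵇ p (y ∷ ys) ≤ countᵇ q (x ∷ xs)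
countᵇ-∷-mono p q {x} {y} py⇒qx le with p y | q x
... | true  | true  = s≤s le
... | true  | false = ⊥-elim (py⇒qx _)
... | false | true  = m≤n⇒m≤1+n le
... | false | false = le

keep≗filterᵇ : ∀ {A : Set} (p : A → Bool) → keep p ≗ filterᵇ p
keep≗filterᵇ p [] = refl
keep≗filterᵇ p (x ∷ xs) with p x
... | true  = cong (x ∷_) (keep≗filterᵇ p xs)
... | false = keep≗filterᵇ p xs

countᵇ-↭ : ∀ {A : Set} (p : A → Bool) {xs ys} → xs ↭ ys → countᵇ p xs ≡ countᵇ p ys
countᵇ-↭ p {xs} {ys} xs↭ys = begin
  length (keep p xs)     ≡⟨ cong length (keep≗filterᵇ p xs) ⟩
  length (filterᵇ p xs)  ≡⟨ ↭-length (filter-↭ _ xs↭ys) ⟩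
  length (filterᵇ p ys)  ≡⟨ cong length (keep≗filterᵇ p ys) ⟨
  length (keep p ys)     ∎
  where open ≡-Reasoning

keep-none : ∀ {A : Set} (p : A → Bool) {xs} → All (λ x → ¬ T (p x)) xs → keep p xs ≡ []
keep-none p {[]}     []           = refl
keep-none p {x ∷ xs} (¬px ∷ ¬pxs) with p x
... | true  = ⊥-elim (¬px _)
... | false = keep-none p ¬pxs

indicator-≡+< : ∀ x i → indicator (x ≡ᵇ i) + indicator (x <ᵇ i) ≡ indicator (x <ᵇ suc i)
indicator-≡+< zero    zero    = refl
indicator-≡+< zero    (suc i) = refl
indicator-≡+< (suc x) zero    = refl
indicator-≡+< (suc x) (suc i) = indicator-≡+< x i

countᵇ-≡+< : ∀ i xs → countᵇ (_≡ᵇ i) xs + countᵇ (_<ᵇ i) xs ≡ countᵇ (_<ᵇ suc i) xs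
countᵇ-≡+< i []       = refl
countᵇ-≡+< i (x ∷ xs) = begin
  countᵇ (_≡ᵇ i) (x ∷ xs) + countᵇ (_<ᵇ i) (x ∷ xs)
    ≡⟨ cong₂ _+_ (countᵇ-∷ (_≡ᵇ i) x xs) (countᵇ-∷ (_<ᵇ i) x xs) ⟩
  (indicator (x ≡ᵇ i) + countᵇ (_≡ᵇ i) xs) + (indicator (x <ᵇ i) + countᵇ (_<ᵇ i) xs)
    ≡⟨ interchange (indicator (x ≡ᵇ i)) _ _ _ ⟩
  (indicator (x ≡ᵇ i) + indicator (x <ᵇ i)) + (countᵇ (_≡ᵇ i) xs + countᵇ (_<ᵇ i) xs)
    ≡⟨ cong₂ _+_ (indicator-≡+< x i) (countᵇ-≡+< i xs) ⟩
  indicator (x <ᵇ suc i) + countᵇ (_<ᵇ suc i) xs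
    ≡⟨ countᵇ-∷ (_<ᵇ suc i) x xs ⟨
  countᵇ (_<ᵇ suc i) (x ∷ xs)
    ∎
  where open ≡-Reasoning

countᵇ-≡-take : ∀ {i} A R → (∀ c → at R c ≡ i → c < A) → countᵇ (_≡ᵇ i) (take A R) ≡ countᵇ (_≡ᵇ i) R
countᵇ-≡-take zero    []      _      = refl
countᵇ-≡-take (suc A) []      _      = refl
countᵇ-≡-take {i} zero (x ∷ R) before with x ≡ᵇ i | proof (x ≟ i)
... | true  | ofʸ x≡i = ⊥-elim (n≮0 (before 0 x≡i))
... | false | _       = countᵇ-≡-take zero R (λ c eq → ⊥-elim (n≮0 (before (suc c) eq)))
countᵇ-≡-take {i} (suc A) (x ∷ R) before with x ≡ᵇ i
... | true  = cong suc (countᵇ-≡-take A R (λ c eq → ≤-pred (before (suc c) eq)))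
... | false = countᵇ-≡-take A R (λ c eq → ≤-pred (before (suc c) eq))

countᵇ-take-mono : ∀ (p q : ℕ → Bool) A {xs ys} → length ys ≤ length xs
  → (∀ c → c < length ys → T (p (at ys c)) → T (q (at xs c))) → countᵇ p (take A ys) ≤ countᵇ q (take A xs)
countᵇ-take-mono p q zero    {_}     {_}     _          _         = z≤n
countᵇ-take-mono p q (suc A) {_}     {[]}    _          _         = z≤n
countᵇ-take-mono p q (suc A) {_ ∷ xs} {_ ∷ ys} (s≤s len≤) pointwise =
  countᵇ-∷-mono p q {xs = take A xs} {ys = take A ys} (pointwise 0 z<s)
    (countᵇ-take-mono p q A len≤ (λ c c< → pointwise (suc c) (s<s c<)))

shift-at : ∀ (p : ℕ → Bool) y a {lo z} → lo < z → T (p (at (y ∷ a) (z ∸ lo)))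
  → suc lo ≤ z × T (p (at a (z ∸ suc lo)))
shift-at p y a {z = suc z} lo<z@(s≤s lo≤z) pz = lo<z , subst (T ∘ p) (cong (at (y ∷ a)) (+-∸-assoc 1 lo≤z)) pz

-- ¬ T (p 0) is needed because at returns 0 past the end of a.
length≤countᵇ-at : ∀ (p : ℕ → Bool) → ¬ T (p 0) → ∀ a lo {xs} → AllPairs _<_ xs
  → All (λ x → lo ≤ x × T (p (at a (x ∸ lo)))) xs → length xs ≤ countᵇ p a
length≤countᵇ-at p ¬p0 a       lo {[]}    _ _                = z≤n
length≤countᵇ-at p ¬p0 []      lo {_ ∷ _} _ ((_ , p[0]) ∷ _) = ⊥-elim (¬p0 p[0])
length≤countᵇ-at p ¬p0 (y ∷ a) lo {x ∷ xs} (x<xs ∷ sorted) ((lo≤x , px) ∷ pxs) with m≤n⇒m<n∨m≡n lo≤x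
... | inj₁ lo<x = ≤-trans
  (length≤countᵇ-at p ¬p0 a (suc lo) (x<xs ∷ sorted)
     (shift-at p y a lo<x px ∷ All.zipWith (λ (x<z , _ , pz) → shift-at p y a (<-trans lo<x x<z) pz) (x<xs , pxs)))
  (countᵇ-≤-∷ p y a)
... | inj₂ refl = ≤-trans
  (s≤s (length≤countᵇ-at p ¬p0 a (suc x) sorted (All.zipWith (λ (x<z , _ , pz) → shift-at p y a x<z pz) (x<xs , pxs))))
  (≤-reflexive (sym (countᵇ-accept p {xs = a} (subst (T ∘ p ∘ at (y ∷ a)) (n∸n≡0 x) px))))

at-≤-head : ∀ {x xs} → Linked _≥_ (x ∷ xs) → ∀ r → at (x ∷ xs) r ≤ x
at-≤-head _          zero    = ≤-refl
at-≤-head [-]        (suc r) = z≤n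
at-≤-head (x≥y ∷ dx) (suc r) = ≤-trans (at-≤-head dx r) x≥y

insD-↭ : ∀ x ys → insD x ys ↭ x ∷ ys
insD-↭ x []       = ↭-refl
insD-↭ x (y ∷ ys) with y ≤ᵇ x
... | true  = ↭-refl
... | false = ↭-trans (prep y (insD-↭ x ys)) (swap y x ↭-refl)

sortD-↭ : ∀ xs → sortD xs ↭ xs
sortD-↭ []       = ↭-refl
sortD-↭ (x ∷ xs) = ↭-trans (insD-↭ x (sortD xs)) (prep x (sortD-↭ xs))

insD-decreasing-under : ∀ {x z ys} → x ≤ z → Linked _≥_ (z ∷ ys) → Linked _≥_ (z ∷ insD x ys)
insD-decreasing-under {ys = []}     x≤z _ = x≤z ∷ [-]
insD-decreasing-under {x} {ys = y ∷ ys} x≤z (z≥y ∷ dys) with y ≤ᵇ x | ≤ᵇ-reflects-≤ y x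
... | true  | ofʸ y≤x = x≤z ∷ y≤x ∷ dys
... | false | ofⁿ y≰x = z≥y ∷ insD-decreasing-under (<⇒≤ (≰⇒> y≰x)) dys

insD-decreasing : ∀ x {ys} → Linked _≥_ ys → Linked _≥_ (insD x ys)
insD-decreasing x {[]}     _   = [-]
insD-decreasing x {y ∷ ys} dys with y ≤ᵇ x | ≤ᵇ-reflects-≤ y x
... | true  | ofʸ y≤x = y≤x ∷ dys
... | false | ofⁿ y≰x = insD-decreasing-under (<⇒≤ (≰⇒> y≰x)) dys

sortD-decreasing : ∀ xs → Linked _≥_ (sortD xs)
sortD-decreasing []       = []
sortD-decreasing (x ∷ xs) = insD-decreasing x (sortD-decreasing xs)

decreasing-drop1 : ∀ {mu} → Linked _≥_ mu → Linked _≥_ (drop 1 mu)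
decreasing-drop1 []      = []
decreasing-drop1 [-]     = []
decreasing-drop1 (_ ∷ d) = d

head-drop1-≤ : ∀ {mu} → Linked _≥_ mu → at (drop 1 mu) 0 ≤ at mu 0
head-drop1-≤ []        = z≤n
head-drop1-≤ [-]       = z≤n
head-drop1-≤ (x≥y ∷ _) = x≥y

⊆ₚ-drop1 : ∀ mu {r nu} → mu ⊆ₚ (r ∷ nu) → drop 1 mu ⊆ₚ nu
⊆ₚ-drop1 []       _   _ = z≤n
⊆ₚ-drop1 (x ∷ mu) mu⊆ i = mu⊆ (suc i)

-- conj p c is the (c+1)-st part of the conjugate partition of p.
conj : List ℕ → ℕ → ℕ
conj p c = countᵇ (c <ᵇ_) p

conj-head : ∀ mu c → conj mu c ≡ indicator (c <ᵇ at mu 0) + conj (drop 1 mu) c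
conj-head []       c = refl
conj-head (x ∷ mu) c = countᵇ-∷ (c <ᵇ_) x mu

conj-⊆ₚ[] : ∀ {mu} c → mu ⊆ₚ [] → conj mu c ≡ 0
conj-⊆ₚ[] {[]}     c _   = refl
conj-⊆ₚ[] {x ∷ mu} c mu⊆ with mu⊆ 0
... | z≤n = conj-⊆ₚ[] {mu} c (λ i → mu⊆ (suc i))

conj-keep-positive : ∀ xs c → conj (keep (0 <ᵇ_) xs) c ≡ conj xs c
conj-keep-positive []           c = refl
conj-keep-positive (zero  ∷ xs) c = conj-keep-positive xs c
conj-keep-positive (suc x ∷ xs) c with c <ᵇ suc x
... | true  = cong suc (conj-keep-positive xs c)
... | false = conj-keep-positive xs c

conj-cupP : ∀ a lam c → conj (cupP a lam) c ≡ conj a c + conj lam c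
conj-cupP a lam c = begin
  conj (sortD (keep (0 <ᵇ_) (a ++ lam))) c  ≡⟨ countᵇ-↭ (c <ᵇ_) (sortD-↭ (keep (0 <ᵇ_) (a ++ lam))) ⟩
  conj (keep (0 <ᵇ_) (a ++ lam)) c          ≡⟨ conj-keep-positive (a ++ lam) c ⟩
  conj (a ++ lam) c                         ≡⟨ countᵇ-++ (c <ᵇ_) a lam ⟩
  conj a c + conj lam c                     ∎
  where open ≡-Reasoning

conj-≤ : ∀ {xs} r {c} → Linked _≥_ xs → at xs r ≤ c → conj xs c ≤ r
conj-≤ {[]}     r       _  _ = z≤n
conj-≤ {x ∷ xs} zero {c} dx x≤c with c <ᵇ x | <ᵇ-reflects-< c x
... | true  | ofʸ c<x = ⊥-elim (<⇒≱ c<x x≤c)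
... | false | _       = conj-≤ zero (Linked.tail dx) (≤-trans (at-≤-head dx 1) x≤c)
conj-≤ {x ∷ xs} (suc r) {c} dx p with c <ᵇ x
... | true  = s≤s (conj-≤ r (Linked.tail dx) p)
... | false = m≤n⇒m≤1+n (conj-≤ r (Linked.tail dx) p)

conj-> : ∀ {xs} r {c} → Linked _≥_ xs → c < at xs r → r < conj xs c
conj-> {x ∷ xs} r {c} dx p with c <ᵇ x | <ᵇ-reflects-< c x
... | false | ofⁿ c≮x = ⊥-elim (c≮x (<-≤-trans p (at-≤-head dx r)))
... | true  | _ with r
...   | zero  = s≤s z≤n
...   | suc r = s≤s (conj-> r (Linked.tail dx) p)

⊆ₚ-from-conj : ∀ {lam mu} → Linked _≥_ lam → Linked _≥_ mu → (∀ c → conj lam c ≤ conj mu c) → lam ⊆ₚ mu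
⊆ₚ-from-conj {lam} {mu} dlam dmu conj≤ r with at lam r ≤? at mu r
... | yes lamr≤mur = lamr≤mur
... | no  lamr≰mur = ⊥-elim (n≮n r (begin-strict
  r                   <⟨ conj-> r dlam (≰⇒> lamr≰mur) ⟩
  conj lam (at mu r)  ≤⟨ conj≤ (at mu r) ⟩
  conj mu (at mu r)   ≤⟨ conj-≤ r dmu ≤-refl ⟩
  r                   ∎))
  where open ≤-Reasoning

at-padded-< : ∀ k (w : List ℕ) {c} → c < k → at (replicate k 0 ++ w) c ≡ 0
at-padded-< (suc k) w {zero}  _        = refl
at-padded-< (suc k) w {suc c} (s≤s c<) = at-padded-< k w c<

at-padded-zero : ∀ k {w : List ℕ} {c} → All (0 <_) w → c < length (replicate k 0 ++ w)
  → at (replicate k 0 ++ w) c ≡ 0 → c < k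
at-padded-zero zero    pw c< empty = ⊥-elim (<-irrefl (sym empty) (at-positive pw c<))
at-padded-zero (suc k) {c = zero}  pw _        _     = z<s
at-padded-zero (suc k) {c = suc c} pw (s≤s c<) empty = s<s (at-padded-zero k pw c< empty)

padded-indicator : ∀ k {w : List ℕ} c → All (0 <_) w
  → indicator (0 <ᵇ at (replicate k 0 ++ w) c) + indicator (c <ᵇ k) ≡ indicator (c <ᵇ k + length w)
padded-indicator zero    {[]}    c       _          = refl
padded-indicator zero    {x ∷ w} zero    (s≤s _ ∷ _) = refl
padded-indicator zero    {x ∷ w} (suc c) (_ ∷ pw)   = padded-indicator zero c pw
padded-indicator (suc k) zero    _  = refl
padded-indicator (suc k) (suc c) pw = padded-indicator k c pw

padded-length : ∀ k r (w : List ℕ) → k ≤ r → length w ≡ r ∸ k → length (replicate k 0 ++ w) ≡ r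
padded-length k r w k≤r lw = begin
  length (replicate k 0 ++ w)         ≡⟨ length-++ (replicate k 0) ⟩
  length (replicate k 0) + length w   ≡⟨ cong₂ _+_ (length-replicate k) lw ⟩
  k + (r ∸ k)                         ≡⟨ m+[n∸m]≡n k≤r ⟩
  r                                   ∎
  where open ≡-Reasoning

data Filling : List ℕ → List ℕ → List (List ℕ) → Set where
  []  : ∀ {mu} → Filling [] mu []
  row : ∀ {r nu mu w Rs} → All (0 <_) w → length w ≡ r ∸ at mu 0 → Filling nu (drop 1 mu) Rs
      → Filling (r ∷ nu) mu ((replicate (at mu 0) 0 ++ w) ∷ Rs)

letters-positive : ∀ m → All (0 <_) (letters m)
letters-positive m = map⁺ (All.universal (λ _ → z<s) (upTo m))

allWords-positive : ∀ m k → All (λ w → All (0 <_) w × length w ≡ k) (allWords m k)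
allWords-positive m zero    = ([] , refl) ∷ []
allWords-positive m (suc k) = concat⁺ (map⁺ (All.map extend (letters-positive m)))
  where
  extend : ∀ {x} → 0 < x → All (λ w → All (0 <_) w × length w ≡ suc k) (map (x ∷_) (allWords m k))
  extend x>0 = map⁺ (All.map (λ (pw , lw) → x>0 ∷ pw , cong suc lw) (allWords-positive m k))

fills-Filling : ∀ m nu mu → All (Filling nu mu) (fills m nu mu)
fills-Filling m []       mu = [] ∷ []
fills-Filling m (r ∷ nu) mu = concat⁺ (map⁺ (All.map extend (allWords-positive m (r ∸ at mu 0))))
  where
  extend : ∀ {w} → All (0 <_) w × length w ≡ r ∸ at mu 0
         → All (Filling (r ∷ nu) mu) (map ((replicate (at mu 0) 0 ++ w) ∷_) (fills m nu (drop 1 mu)))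
  extend (pw , lw) = map⁺ (All.map (row pw lw) (fills-Filling m nu (drop 1 mu)))

Filling-row-length : ∀ {r nu mu R Rs} → Filling (r ∷ nu) mu (R ∷ Rs) → mu ⊆ₚ (r ∷ nu) → length R ≡ r
Filling-row-length (row {w = w} _ lw _) mu⊆ = padded-length _ _ w (mu⊆ 0) lw

ColumnStrict : List ℕ → List ℕ → Set
ColumnStrict R₁ R₂ = ∀ c → c < length R₂ → at R₂ c ≡ 0 ⊎ at R₁ c < at R₂ c

Above : List ℕ → List ℕ → Set
Above R₁ R₂ = length R₂ ≤ length R₁ × (∀ c → c < length R₂ → at R₁ c ≡ 0 ⊎ at R₁ c < at R₂ c)

rows-Above : ∀ {r₁ r₂ nu mu R₁ R₂ Rs} → Filling (r₁ ∷ r₂ ∷ nu) mu (R₁ ∷ R₂ ∷ Rs) → r₂ ≤ r₁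
  → Linked _≥_ mu → mu ⊆ₚ (r₁ ∷ r₂ ∷ nu) → ColumnStrict R₁ R₂ → Above R₁ R₂
rows-Above {mu = mu} {R₁} {R₂} f@(row {w = w₁} _ _ f₂@(row pw₂ _ _)) r₂≤r₁ dmu mu⊆ strict = length-≤ , cell
  where
  length-≤ : length R₂ ≤ length R₁
  length-≤ = subst₂ _≤_ (sym (Filling-row-length f₂ (⊆ₚ-drop1 mu mu⊆))) (sym (Filling-row-length f mu⊆)) r₂≤r₁
  cell : ∀ c → c < length R₂ → at R₁ c ≡ 0 ⊎ at R₁ c < at R₂ c
  cell c c< with strict c c<
  ... | inj₂ lt    = inj₂ lt
  ... | inj₁ empty = inj₁ (at-padded-< (at mu 0) w₁ (<-≤-trans (at-padded-zero _ pw₂ c< empty) (head-drop1-≤ dmu)))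

Filling⇒Above : ∀ {nu mu Rs} → Filling nu mu Rs → Linked _≥_ nu → Linked _≥_ mu → mu ⊆ₚ nu
  → Linked ColumnStrict Rs → Linked Above Rs
Filling⇒Above []                            _              _   _   _              = []
Filling⇒Above (row _ _ [])                  _              _   _   _              = [-]
Filling⇒Above {mu = mu} f@(row _ _ f₂@(row _ _ _)) (r₁≥r₂ ∷ dnu) dmu mu⊆ (strict ∷ css) =
  rows-Above f r₁≥r₂ dmu mu⊆ strict ∷ Filling⇒Above f₂ dnu (decreasing-drop1 dmu) (⊆ₚ-drop1 mu mu⊆) css

column : ℕ → List (List ℕ) → List ℕ
column c Rs = keep (0 <ᵇ_) (map (λ R → at R c) Rs)

length-column : ∀ {nu mu Rs} c → Filling nu mu Rs → mu ⊆ₚ nu → length (column c Rs) + conj mu c ≡ conj nu c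
length-column {mu = mu} c [] mu⊆ = conj-⊆ₚ[] {mu} c mu⊆
length-column {r ∷ nu} {mu} c (row {w = w} {Rs} pw lw f) mu⊆ = begin
  length (column c (R ∷ Rs)) + conj mu c
    ≡⟨ cong₂ _+_ (countᵇ-∷ (0 <ᵇ_) (at R c) (map (λ R → at R c) Rs)) (conj-head mu c) ⟩
  (indicator (0 <ᵇ at R c) + length (column c Rs)) + (indicator (c <ᵇ k) + conj (drop 1 mu) c)
    ≡⟨ interchange (indicator (0 <ᵇ at R c)) _ _ _ ⟩
  (indicator (0 <ᵇ at R c) + indicator (c <ᵇ k)) + (length (column c Rs) + conj (drop 1 mu) c)
    ≡⟨ cong₂ _+_ (padded-indicator k c pw) (length-column c f (⊆ₚ-drop1 mu mu⊆)) ⟩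
  indicator (c <ᵇ k + length w) + conj nu c
    ≡⟨ cong (λ n → indicator (c <ᵇ n) + conj nu c) (trans (cong (_+_ k) lw) (m+[n∸m]≡n (mu⊆ 0))) ⟩
  indicator (c <ᵇ r) + conj nu c
    ≡⟨ countᵇ-∷ (c <ᵇ_) r nu ⟨
  conj (r ∷ nu) c
    ∎
  where
  open ≡-Reasoning
  k : ℕ
  k = at mu 0
  R : List ℕ
  R = replicate k 0 ++ w

column-∷-positive : ∀ {c R} Rs → 0 < at R c → column c (R ∷ Rs) ≡ at R c ∷ column c Rs
column-∷-positive {c} {R} Rs pos with 0 <ᵇ at R c | <ᵇ-reflects-< 0 (at R c)
... | true  | _        = refl
... | false | ofⁿ ¬pos = ⊥-elim (¬pos pos)

column-below-short-row : ∀ {c R Rs} → Linked Above (R ∷ Rs) → length R ≤ c → column c (R ∷ Rs) ≡ []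
column-below-short-row {c} {R} {[]}     _                   len≤ rewrite at-beyond R len≤ = refl
column-below-short-row {c} {R} {_ ∷ _} ((len₂≤ , _) ∷ chain) len≤ rewrite at-beyond R len≤ =
  column-below-short-row chain (≤-trans len₂≤ len≤)

column-above : ∀ {c R Rs} → Linked Above (R ∷ Rs) → 0 < at R c → All (at R c <_) (column c Rs)
column-above {Rs = []} _ _ = []
column-above {c} {R} {R₂ ∷ Rs} ((_ , cell) ∷ chain) pos with c <? length R₂
... | no c≮ rewrite column-below-short-row chain (≮⇒≥ c≮) = []
... | yes c< with cell c c<
...   | inj₁ empty = ⊥-elim (<-irrefl (sym empty) pos)
...   | inj₂ lt rewrite column-∷-positive {c} {R₂} Rs (<-trans pos lt) =
  lt ∷ All.map (<-trans lt) (column-above chain (<-trans pos lt))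

column-increasing : ∀ {c Rs} → Linked Above Rs → AllPairs _<_ (column c Rs)
column-increasing {Rs = []} _ = []
column-increasing {c} {R ∷ Rs} chain with 0 <ᵇ at R c | <ᵇ-reflects-< 0 (at R c)
... | true  | ofʸ pos = column-above chain pos ∷ column-increasing (Linked.tail chain)
... | false | _       = column-increasing (Linked.tail chain)

column⁺ : ∀ {P : ℕ → Set} {c Rs} → All (λ R → 0 < at R c → P (at R c)) Rs → All P (column c Rs)
column⁺ [] = []
column⁺ {c = c} {R ∷ Rs} (PR ∷ PRs) with 0 <ᵇ at R c | <ᵇ-reflects-< 0 (at R c)
... | true  | ofʸ pos = PR pos ∷ column⁺ PRs
... | false | _       = column⁺ PRs

above-<ᵇ : ∀ {i R₁ R₂} → 0 < i → Above R₁ R₂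
  → ∀ c → c < length R₂ → T (at R₂ c <ᵇ suc i) → T (at R₁ c <ᵇ i)
above-<ᵇ {i} {R₁} {R₂} 0<i (_ , cell) c c< below with cell c c<
... | inj₁ empty = <⇒<ᵇ (subst (_< i) (sym empty) 0<i)
... | inj₂ lt    = <⇒<ᵇ (<-≤-trans lt (≤-pred (<ᵇ⇒< (at R₂ c) (suc i) below)))

-- By above-<ᵇ, every cell ≤ i of a row sits below a cell < i of the row above, so the
-- occurrences of i in the rows below R are bounded by the cells < i among the first A cells of R.
occurrences-≤ : ∀ {i} A {R Rs} → 0 < i → Linked Above (R ∷ Rs)
  → All (λ R → ∀ c → at R c ≡ i → c < A) (R ∷ Rs)
  → countᵇ (_≡ᵇ i) (concat (R ∷ Rs)) ≤ countᵇ (_<ᵇ suc i) (take A R)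
occurrences-≤ {i} A {R} {[]} _ _ (before ∷ []) = begin
  countᵇ (_≡ᵇ i) (R ++ [])                               ≡⟨ cong (countᵇ (_≡ᵇ i)) (++-identityʳ R) ⟩
  countᵇ (_≡ᵇ i) R                                       ≡⟨ countᵇ-≡-take A R before ⟨
  countᵇ (_≡ᵇ i) (take A R)                              ≤⟨ m≤m+n _ _ ⟩
  countᵇ (_≡ᵇ i) (take A R) + countᵇ (_<ᵇ i) (take A R)  ≡⟨ countᵇ-≡+< i (take A R) ⟩
  countᵇ (_<ᵇ suc i) (take A R)                          ∎
  where open ≤-Reasoning
occurrences-≤ {i} A {R₁} {R₂ ∷ Rs} 0<i (above ∷ chain) (before ∷ befores) = begin
  countᵇ (_≡ᵇ i) (R₁ ++ concat (R₂ ∷ Rs))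
    ≡⟨ countᵇ-++ (_≡ᵇ i) R₁ _ ⟩
  countᵇ (_≡ᵇ i) R₁ + countᵇ (_≡ᵇ i) (concat (R₂ ∷ Rs))
    ≤⟨ +-monoʳ-≤ _ (occurrences-≤ A 0<i chain befores) ⟩
  countᵇ (_≡ᵇ i) R₁ + countᵇ (_<ᵇ suc i) (take A R₂)
    ≤⟨ +-monoʳ-≤ _ (countᵇ-take-mono (_<ᵇ suc i) (_<ᵇ i) A (proj₁ above) (above-<ᵇ {i} {R₁} {R₂} 0<i above)) ⟩
  countᵇ (_≡ᵇ i) R₁ + countᵇ (_<ᵇ i) (take A R₁)
    ≡⟨ cong (_+ countᵇ (_<ᵇ i) (take A R₁)) (countᵇ-≡-take A R₁ before) ⟨
  countᵇ (_≡ᵇ i) (take A R₁) + countᵇ (_<ᵇ i) (take A R₁)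
    ≡⟨ countᵇ-≡+< i (take A R₁) ⟩
  countᵇ (_<ᵇ suc i) (take A R₁)
    ∎
  where open ≤-Reasoning

letter-count-≤ : ∀ {i} A {Rs} → 0 < i → Linked Above Rs → All (λ R → ∀ c → at R c ≡ i → c < A) Rs
  → countᵇ (_≡ᵇ i) (concat Rs) ≤ A
letter-count-≤ A {[]}    _   _     _       = z≤n
letter-count-≤ {i} A {R ∷ Rs} 0<i chain befores = begin
  countᵇ (_≡ᵇ i) (concat (R ∷ Rs))  ≤⟨ occurrences-≤ A 0<i chain befores ⟩
  countᵇ (_<ᵇ suc i) (take A R)     ≤⟨ countᵇ-≤-length (_<ᵇ suc i) (take A R) ⟩
  length (take A R)                 ≡⟨ length-take A R ⟩
  A ⊓ length R                      ≤⟨ m⊓n≤m A (length R) ⟩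
  A                                 ∎
  where open ≤-Reasoning

allᵇ⇒All : ∀ {A : Set} (p : A → Bool) xs → T (allᵇ p xs) → All (T ∘ p) xs
allᵇ⇒All p []       _ = []
allᵇ⇒All p (x ∷ xs) t = let px , pxs = Equivalence.to (T-∧ {p x}) t in px ∷ allᵇ⇒All p xs pxs

allᵇ-upTo : ∀ (p : ℕ → Bool) n → T (allᵇ p (upTo n)) → ∀ {c} → c < n → T (p c)
allᵇ-upTo p n t = applyUpTo⁻ id n (allᵇ⇒All p (upTo n) t)

colStrict⇒Linked : ∀ Rs → T (colStrict Rs) → Linked ColumnStrict Rs
colStrict⇒Linked []                 _ = []
colStrict⇒Linked (R ∷ [])           _ = [-]
colStrict⇒Linked (R₁ ∷ Rs@(R₂ ∷ _)) t =
  let cells , rest = Equivalence.to (T-∧ {allᵇ _ (upTo (length R₂))}) t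
  in strict cells ∷ colStrict⇒Linked Rs rest
  where
  strict : T (allᵇ (λ c → (at R₂ c ≡ᵇ 0) ∨ (at R₁ c <ᵇ at R₂ c)) (upTo (length R₂))) → ColumnStrict R₁ R₂
  strict cells c c< with Equivalence.to (T-∨ {at R₂ c ≡ᵇ 0}) (allᵇ-upTo _ (length R₂) cells c<)
  ... | inj₁ empty = inj₁ (≡ᵇ⇒≡ (at R₂ c) 0 empty)
  ... | inj₂ lt    = inj₂ (<ᵇ⇒< (at R₁ c) (at R₂ c) lt)

containedᵇ⇒⊆ₚ : ∀ mu nu → T (containedᵇ mu nu) → mu ⊆ₚ nu
containedᵇ⇒⊆ₚ mu nu t r with r <? length mu
... | yes r< = ≤ᵇ⇒≤ (at mu r) (at nu r) (allᵇ-upTo _ (length mu) t r<)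
... | no  r≮ rewrite at-beyond mu (≮⇒≥ r≮) = z≤n

Obstruction : List ℕ → List ℕ → List ℕ → List ℕ → Set
Obstruction a lam b mu = (Σ ℕ λ l → at a l < at b l) ⊎ ¬ (lam ⊆ₚ mu)

module Dominant (m : ℕ) (a lam b mu : List ℕ) where
  open Tab m a lam b mu using (valid; nu; S; chargeAB; Ddom)

  -- Letter i may only occupy columns c < a_i; letters are 1-based, a and columns 0-based.
  WithinColumns : List ℕ → Set
  WithinColumns R = ∀ c → 0 < at R c → c < at a (at R c ∸ 1)

  record Valid (Rs : List (List ℕ)) : Set where
    field
      columnStrict  : Linked ColumnStrict Rs
      content       : ∀ {l} → l < m → countᵇ (_≡ᵇ suc l) (concat Rs) ≡ at b l
      withinColumns : All WithinColumns Rs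

  valid⇒Valid : ∀ Rs → T (valid Rs) → Valid Rs
  valid⇒Valid Rs t with Equivalence.to (T-∧ {allᵇ incᵇ Rs}) t
  ... | _ , t₁ with Equivalence.to (T-∧ {colStrict Rs}) t₁
  ... | strict , t₂ with Equivalence.to (T-∧ {allᵇ _ (letters m)}) t₂
  ... | counts , bounds = record
    { columnStrict  = colStrict⇒Linked Rs strict
    ; content       = λ {l} l<m → ≡ᵇ⇒≡ _ (at b l) (applyUpTo⁻ id m (map⁻ (allᵇ⇒All _ (letters m) counts)) l<m)
    ; withinColumns = All.map (λ {R} → within {R}) (allᵇ⇒All _ Rs bounds)
    }
    where
    within : ∀ {R} → T (allᵇ (λ c → (at R c ≡ᵇ 0) ∨ (c <ᵇ at a (at R c ∸ 1))) (upTo (length R))) → WithinColumns R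
    within {R} tR c pos with Equivalence.to (T-∨ {at R c ≡ᵇ 0}) (allᵇ-upTo _ (length R) tR (at-positive⇒< R pos))
    ... | inj₁ empty = ⊥-elim (<-irrefl (sym (≡ᵇ⇒≡ (at R c) 0 empty)) pos)
    ... | inj₂ lt    = <ᵇ⇒< c (at a (at R c ∸ 1)) lt

  module _ (lb : length b ≡ m) (dlam : Linked _≥_ lam) (dmu : Linked _≥_ mu)
           (obstruction : Obstruction a lam b mu) where

    no-valid-filling : mu ⊆ₚ nu → ∀ {Rs} → Filling nu mu Rs → ¬ T (valid Rs)
    no-valid-filling mu⊆ {Rs} f t =
      [ (λ (l , al<bl) → letters-fit l al<bl) , (λ lam⊈mu → lam⊈mu columns-fit) ]′ obstruction
      where
      open Valid (valid⇒Valid Rs t)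
      chain : Linked Above Rs
      chain = Filling⇒Above f (sortD-decreasing (keep (0 <ᵇ_) (a ++ lam))) dmu mu⊆ columnStrict

      letters-fit : ∀ l → ¬ (at a l < at b l)
      letters-fit l al<bl = <⇒≱ al<bl (begin
        at b l                              ≡⟨ content (subst (l <_) lb (at-positive⇒< b (≤-<-trans z≤n al<bl))) ⟨
        countᵇ (_≡ᵇ suc l) (concat Rs)      ≤⟨ letter-count-≤ (at a l) z<s chain (All.map (λ {R} → before {R}) withinColumns) ⟩
        at a l                              ∎)
        where
        open ≤-Reasoning
        before : ∀ {R} → WithinColumns R → ∀ c → at R c ≡ suc l → c < at a l
        before within c eq = subst (λ x → c < at a (x ∸ 1)) eq (within c (subst (0 <_) (sym eq) z<s))

      column-length-≤ : ∀ c → length (column c Rs) ≤ conj a c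
      column-length-≤ c = length≤countᵇ-at (c <ᵇ_) (λ ()) a 1 (column-increasing chain)
        (column⁺ (All.map (λ {R} within pos → pos , <⇒<ᵇ {c} {at a (at R c ∸ 1)} (within c pos)) withinColumns))

      columns-fit : lam ⊆ₚ mu
      columns-fit = ⊆ₚ-from-conj dlam dmu (λ c → +-cancelˡ-≤ (conj a c) _ _ (begin
        conj a c + conj lam c             ≡⟨ conj-cupP a lam c ⟨
        conj nu c                         ≡⟨ length-column c f mu⊆ ⟨
        length (column c Rs) + conj mu c  ≤⟨ +-monoˡ-≤ (conj mu c) (column-length-≤ c) ⟩
        conj a c + conj mu c              ∎))
        where open ≤-Reasoning

    S-empty : S ≡ []
    S-empty with containedᵇ mu nu in contained
    ... | false = refl
    ... | true  = keep-none valid (All.map (λ {Rs} → no-valid-filling mu⊆ {Rs}) (fills-Filling m nu mu))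
      where
      mu⊆ : mu ⊆ₚ nu
      mu⊆ = containedᵇ⇒⊆ₚ mu nu (Equivalence.from T-≡ contained)

    Ddom-vanishes : ∀ k → Ddom k ≡ + 0
    Ddom-vanishes (+ k)    = cong (λ Ts → + countᵇ (λ Rs → chargeAB Rs ≡ᵇ k) Ts) S-empty
    Ddom-vanishes -[1+ _ ] = refl

firstAsc-ascent : ∀ a {i} → firstAsc a ≡ just i → suc i < length a × at a i < at a (suc i)
firstAsc-ascent []          ()
firstAsc-ascent (x ∷ [])    ()
firstAsc-ascent (x ∷ y ∷ a) eq with x <ᵇ y | <ᵇ-reflects-< x y
firstAsc-ascent (x ∷ y ∷ a) refl | true  | ofʸ x<y = s<s z<s , x<y
firstAsc-ascent (x ∷ y ∷ a) eq   | false | _ with firstAsc (y ∷ a) in asc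
firstAsc-ascent (x ∷ y ∷ a) ()   | false | _ | nothing
firstAsc-ascent (x ∷ y ∷ a) refl | false | _ | just j =
  let j<len , ascent = firstAsc-ascent (y ∷ a) asc in s<s j<len , ascent

length-swapAt : ∀ i xs → length (swapAt i xs) ≡ length xs
length-swapAt zero    []           = refl
length-swapAt zero    (x ∷ [])     = refl
length-swapAt zero    (x ∷ y ∷ xs) = refl
length-swapAt (suc i) []           = refl
length-swapAt (suc i) (x ∷ xs)     = cong suc (length-swapAt i xs)

at-swapAt-i : ∀ i xs → suc i < length xs → at (swapAt i xs) i ≡ at xs (suc i)
at-swapAt-i zero    (x ∷ [])     (s<s ())
at-swapAt-i zero    (x ∷ y ∷ xs) _        = refl
at-swapAt-i (suc i) (x ∷ xs)     (s<s i<) = at-swapAt-i i xs i<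

at-swapAt-suc-i : ∀ i xs → suc i < length xs → at (swapAt i xs) (suc i) ≡ at xs i
at-swapAt-suc-i zero    (x ∷ [])     (s<s ())
at-swapAt-suc-i zero    (x ∷ y ∷ xs) _        = refl
at-swapAt-suc-i (suc i) (x ∷ xs)     (s<s i<) = at-swapAt-suc-i i xs i<

at-swapAt-other : ∀ i xs {l} → l ≢ i → l ≢ suc i → at (swapAt i xs) l ≡ at xs l
at-swapAt-other zero    []           _   _    = refl
at-swapAt-other zero    (x ∷ [])     _   _    = refl
at-swapAt-other zero    (x ∷ y ∷ xs) {zero}        l≢i _     = ⊥-elim (l≢i refl)
at-swapAt-other zero    (x ∷ y ∷ xs) {suc zero}    _   l≢si  = ⊥-elim (l≢si refl)
at-swapAt-other zero    (x ∷ y ∷ xs) {suc (suc l)} _   _     = refl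
at-swapAt-other (suc i) []           _   _    = refl
at-swapAt-other (suc i) (x ∷ xs)     {zero}  _   _    = refl
at-swapAt-other (suc i) (x ∷ xs)     {suc l} l≢i l≢si =
  at-swapAt-other i xs (l≢i ∘ cong suc) (l≢si ∘ cong suc)

module Recursion (m : ℕ) (lam mu : List ℕ) (dlam : Linked _≥_ lam) (dmu : Linked _≥_ mu) where

  record Obstructed (a b : List ℕ) : Set where
    field
      length-a    : length a ≡ m
      length-b    : length b ≡ m
      obstruction : Obstruction a lam b mu

  module _ {a b i} (ob : Obstructed a b) (asc : firstAsc a ≡ just i) where
    open Obstructed ob
    private
      i<a : suc i < length a
      i<a = proj₁ (firstAsc-ascent a asc)
      i<b : suc i < length b
      i<b = subst (suc i <_) (trans length-a (sym length-b)) i<a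

    swapAt-both : Obstructed (swapAt i a) (swapAt i b)
    swapAt-both = record
      { length-a    = trans (length-swapAt i a) length-a
      ; length-b    = trans (length-swapAt i b) length-b
      ; obstruction = swapped obstruction
      }
      where
      swapped : Obstruction a lam b mu → Obstruction (swapAt i a) lam (swapAt i b) mu
      swapped (inj₂ lam⊈mu) = inj₂ lam⊈mu
      swapped (inj₁ (l , al<bl)) with l ≟ i | l ≟ suc i
      ... | yes refl | _        =
        inj₁ (suc i , subst₂ _<_ (sym (at-swapAt-suc-i i a i<a)) (sym (at-swapAt-suc-i i b i<b)) al<bl)
      ... | no _     | yes refl =
        inj₁ (i , subst₂ _<_ (sym (at-swapAt-i i a i<a)) (sym (at-swapAt-i i b i<b)) al<bl)
      ... | no l≢i   | no l≢si  =
        inj₁ (l , subst₂ _<_ (sym (at-swapAt-other i a l≢i l≢si)) (sym (at-swapAt-other i b l≢i l≢si)) al<bl)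

    -- Swapping a alone moves the smaller entry a_i to position i+1, where b is at least as large.
    swapAt-first : at b i ≤ at b (suc i) → Obstructed (swapAt i a) b
    swapAt-first bi≤ = record
      { length-a    = trans (length-swapAt i a) length-a
      ; length-b    = length-b
      ; obstruction = swapped obstruction
      }
      where
      swapped : Obstruction a lam b mu → Obstruction (swapAt i a) lam b mu
      swapped (inj₂ lam⊈mu) = inj₂ lam⊈mu
      swapped (inj₁ (l , al<bl)) with l ≟ i | l ≟ suc i
      ... | yes refl | _        =
        inj₁ (suc i , subst (_< at b (suc i)) (sym (at-swapAt-suc-i i a i<a)) (<-≤-trans al<bl bi≤))
      ... | no _     | yes refl =
        inj₁ (suc i , subst (_< at b (suc i)) (sym (at-swapAt-suc-i i a i<a)) (<-trans (proj₂ (firstAsc-ascent a asc)) al<bl))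
      ... | no l≢i   | no l≢si  =
        inj₁ (l , subst (_< at b l) (sym (at-swapAt-other i a l≢i l≢si)) al<bl)

  Ddom-vanishes : ∀ {a b} → Obstructed a b → ∀ k → Tab.Ddom m a lam b mu k ≡ + 0
  Ddom-vanishes {a} {b} ob = Dominant.Ddom-vanishes m a lam b mu length-b dlam dmu obstruction
    where open Obstructed ob

  Drec-vanishes : ∀ fuel {a b} → Obstructed a b → ∀ k → Drec m fuel a lam b mu k ≡ + 0
  Drec-vanishes zero    ob   = Ddom-vanishes ob
  Drec-vanishes (suc f) {a} {b} ob k with firstAsc a in asc
  ... | nothing = Ddom-vanishes ob k
  ... | just i with at b (suc i) <ᵇ at b i | <ᵇ-reflects-< (at b (suc i)) (at b i)
  ...   | true  | _        = Drec-vanishes f (swapAt-both ob asc) (k +ℤ + 1)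
  ...   | false | ofⁿ b≮  with at b i ≡ᵇ at b (suc i)
  ...     | true  = Drec-vanishes f (swapAt-first ob asc (≮⇒≥ b≮)) k
  ...     | false rewrite Drec-vanishes f (swapAt-first ob asc (≮⇒≥ b≮)) k
                        | Drec-vanishes f (swapAt-first ob asc (≮⇒≥ b≮)) (k +ℤ + 1)
                        | Drec-vanishes f (swapAt-both ob asc) k = refl

lookup≡at-toList : ∀ {n} (v : Vec ℕ n) (l : Fin n) → lookup v l ≡ at (toList v) (toℕ l)
lookup≡at-toList (x ∷ v) zero    = refl
lookup≡at-toList (x ∷ v) (suc l) = lookup≡at-toList v l

lemma7p3 : (m : ℕ) → 1 ≤ m → (a b : Vec ℕ m) (lam mu : List ℕ)
    → IsPartition lam → IsPartition mu
    → (Σ (Fin m) (λ l → lookup a l < lookup b l)) ⊎ (¬ (lam ⊆ₚ mu))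
    → (k : ℤ) → D m a lam b mu k ≡ + 0
lemma7p3 m _ a b lam mu (dlam , _) (dmu , _) hypothesis =
  Recursion.Drec-vanishes m lam mu dlam dmu (inv (toList a)) record
    { length-a    = length-toList a
    ; length-b    = length-toList b
    ; obstruction = obstruction hypothesis
    }
  where
  obstruction : (Σ (Fin m) (λ l → lookup a l < lookup b l)) ⊎ (¬ (lam ⊆ₚ mu)) → Obstruction (toList a) lam (toList b) mu
  obstruction (inj₁ (l , al<bl)) = inj₁ (toℕ l , subst₂ _<_ (lookup≡at-toList a l) (lookup≡at-toList b l) al<bl)
  obstruction (inj₂ lam⊈mu)      = inj₂ lam⊈mu
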